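{- Let $X$ be an eventually dendric shift space. For every $k\ge1$ there is $n\ge1$ such that, whenever $p,w\in\mathcal L(X)$ with $|p|\le k$ and $|w|\ge n$ are such that $pw$ and $w$ are both left-special, there is a letter $b\in A$ such that $wb$ is the unique left-special right extension of $w$ by a letter and $pwb$ is the unique left-special right extension of $pw$ by a letter, and moreover $\ell(pwb)=\ell(pw)$ and $\ell(wb)=\ell(w)$.
   Context: A shift space on a finite alphabet $A$ is a closed shift-invariant subset of $A^{\mathbb Z}$; $\mathcal L(X)$ is its set of finite factors, $\mathcal L_{\ge n}(X)$ those of length at least $n$. For $w\in\mathcal L(X)$: $L_1(w)=\{a\in A:aw\in\mathcal L(X)\}$, $R_1(w)=\{b\in A:wb\in\mathcal L(X)\}$, $\ell(w)=\mathrm{Card}\,L_1(w)$; $w$ is left-special if $\ell(w)>1$. The extension graph $\mathcal E_1(w)$ is the undirected bipartite graph with vertex set the disjoint union of $L_1(w)$ and $R_1(w)$ and edges the pairs $(a,b)$ with $awb\in\mathcal L(X)$. $X$ is eventually dendric if for some $m\ge0$ all $\mathcal E_1(w)$ with $w\in\mathcal L_{\ge m}(X)$ are trees. -}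

module Defs where

open import Data.Nat using (ℕ; _≤_; _<_)
open import Data.Integer using (ℤ; +_; ∣_∣) renaming (_+_ to _+ℤ_)
open import Data.Fin using (Fin)
open import Data.List using (List; []; _∷_; _++_; length; [_])
open import Data.List.Relation.Unary.Unique.Propositional using (Unique)
open import Data.List.Membership.Propositional using (_∈_)
open import Data.Product using (Σ; ∃; _×_; _,_)
open import Data.Sum using (_⊎_; inj₁; inj₂)
open import Data.Unit using (⊤)
open import Data.Empty using (⊥)
open import Relation.Nullary using (Dec; ¬_)
open import Relation.Binary.PropositionalEquality using (_≡_)
open import Function.Bundles using (_⇔_)

Classical : Set₁
Classical = (P : Set) → Dec P

-- The alphabet is Fin d (an arbitrary finite alphabet, up to renaming).
Config : ℕ → Set
Config d = ℤ → Fin d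

Word : ℕ → Set
Word d = List (Fin d)

σ : ∀ {d} → Config d → Config d
σ x i = x (i +ℤ + 1)

-- A shift space: closed (product topology) and shift-invariant (σ X = X).
record IsShiftSpace {d : ℕ} (X : Config d → Set) : Set where
  field
    closed : ∀ (x : Config d) →
      (∀ (n : ℕ) → ∃ λ y → X y × (∀ i → ∣ i ∣ ≤ n → x i ≡ y i)) → X x
    σ-into : ∀ x → X x → X (σ x)
    σ-onto : ∀ x → X x → ∃ λ y → X y × (∀ i → σ y i ≡ x i)

OccursAt : ∀ {d} → Config d → ℤ → Word d → Set
OccursAt x i [] = ⊤
OccursAt x i (a ∷ w) = (x i ≡ a) × OccursAt x (i +ℤ + 1) w

ℒ : ∀ {d} → (Config d → Set) → Word d → Set
ℒ X w = ∃ λ x → X x × ∃ λ i → OccursAt x i w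

HasCard : ∀ {d} → (Fin d → Set) → ℕ → Set
HasCard {d} P m = Σ (List (Fin d)) λ as →
  (length as ≡ m) × Unique as × (∀ a → P a ⇔ (a ∈ as))

L₁ : ∀ {d} → (Config d → Set) → Word d → Fin d → Set
L₁ X w a = ℒ X (a ∷ w)

R₁ : ∀ {d} → (Config d → Set) → Word d → Fin d → Set
R₁ X w b = ℒ X (w ++ [ b ])

ℓ≡ : ∀ {d} → (Config d → Set) → Word d → ℕ → Set
ℓ≡ X w m = HasCard (L₁ X w) m

LeftSpecial : ∀ {d} → (Config d → Set) → Word d → Set
LeftSpecial X w = ∃ λ m → ℓ≡ X w m × 1 < m

-- the extension graph ℰ₁(w): vertices inj₁ a (a ∈ L₁(w)) and inj₂ b (b ∈ R₁(w))
Vertex : ℕ → Set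
Vertex d = Fin d ⊎ Fin d

IsVertex : ∀ {d} → (Config d → Set) → Word d → Vertex d → Set
IsVertex X w (inj₁ a) = L₁ X w a
IsVertex X w (inj₂ b) = R₁ X w b

Adj : ∀ {d} → (Config d → Set) → Word d → Vertex d → Vertex d → Set
Adj X w (inj₁ a) (inj₂ b) = ℒ X (a ∷ (w ++ [ b ]))
Adj X w (inj₂ b) (inj₁ a) = ℒ X (a ∷ (w ++ [ b ]))
Adj X w (inj₁ _) (inj₁ _) = ⊥
Adj X w (inj₂ _) (inj₂ _) = ⊥

data Walk {d} (X : Config d → Set) (w : Word d) : Vertex d → Vertex d → Set where
  here : ∀ {u} → Walk X w u u
  step : ∀ {u v t} → Adj X w u v → Walk X w v t → Walk X w u t

Chain : ∀ {d} → (Config d → Set) → Word d → List (Vertex d) → Set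
Chain X w [] = ⊤
Chain X w (u ∷ []) = ⊤
Chain X w (u ∷ v ∷ vs) = Adj X w u v × Chain X w (v ∷ vs)

Cycle : ∀ {d} → (Config d → Set) → Word d → Set
Cycle {d} X w = Σ (Vertex d) λ v → Σ (List (Vertex d)) λ vs →
  (2 ≤ length vs) × Unique (v ∷ vs) × Chain X w (v ∷ (vs ++ [ v ]))

IsTree : ∀ {d} → (Config d → Set) → Word d → Set
IsTree {d} X w =
  (∀ (u v : Vertex d) → IsVertex X w u → IsVertex X w v → Walk X w u v)
  × ¬ Cycle X w

EventuallyDendric : ∀ {d} → (Config d → Set) → Set
EventuallyDendric X = ∃ λ m → ∀ w → ℒ X w → m ≤ length w → IsTree X w

-- 1. Forest inequality. If the extension graph ℰ₁(w) has no cycle, then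
--    Σ_b (ℓ(wb) − 1) ≤ ℓ(w) − 1: in a bipartite graph without cycles,
--    Σ_{b ∈ R} (deg b − 1) ≤ |L| − 1, by deleting vertices with at most one
--    neighbour (a graph without such vertices contains a cycle).
-- 2. Unique special extension. With ψ(n) = 2n − 1 (ψ(0) = 0), which is
--    superadditive and strictly so on positive summands, the potential
--    φ(w) = ψ(ℓ(w) − 1) satisfies Σ_b φ(wb) ≤ φ(w) for long w. Hence the total
--    potential of the words of length n is eventually constant (classically),
--    and then Σ_b φ(wb) = φ(w) for every long w. This equality forces a
--    left-special w to have a single left-special extension wb, with ℓ(wb) = ℓ(w).
-- 3. Joint extension. Let χ_q(x) indicate that x and its suffix after q letters
--    are both left special. By 2, Σ_b χ_q(xb) ≤ χ_q(x); the same stabilisation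
--    argument applied to Σ_{q ≤ k} χ_q makes this an equality for long x. For
--    x = pw and q = |p| it produces b with pwb and wb left special, and 2 gives
--    uniqueness of b and the equalities of ℓ.

module Submission where

open import Defs
open import Data.Nat using (ℕ; zero; suc; _+_; _≤_; _<_; _≤′_; ≤′-refl; ≤′-step; z≤n; s≤s; s≤s⁻¹; pred; _≤?_; NonZero; >-nonZero)
open import Data.Nat.Properties
  using ( module ≤-Reasoning; ≤-refl; ≤-reflexive; ≤-trans; ≤-antisym; <-irrefl; <-cmp; <⇒≤; <⇒≱; ≰⇒>; ≮⇒≥; n≮0
        ; n≤1+n; m≤m+n; m≤n+m; m<m+n; m≤n⇒m<n∨m≡n; ≤′⇒≤; ≤⇒≤′
        ; +-assoc; +-comm; +-suc; +-identityʳ; +-cancelˡ-≡; +-mono-≤; +-monoʳ-≤; +-mono-<-≤; +-monoʳ-<; +-commutativeSemigroup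
        ; suc-injective; pred[n]≤n; pred-mono-≤; pred-injective; suc-pred; m≤n⇒m∸n≡0 )
open import Algebra.Properties.CommutativeSemigroup +-commutativeSemigroup using (x∙yz≈y∙xz; interchange)
open import Data.Fin using (Fin) renaming (_≟_ to _≟ᶠ_)
open import Data.List using (List; []; _∷_; _++_; [_]; length; filter; map; allFin; drop; upTo; initLast; _∷ʳ′_)
open import Data.List.Properties using (length-++; length-filter; ++-assoc)
open import Data.List.Membership.Propositional using (_∈_)
open import Data.List.Membership.Propositional.Properties
  using (∈-∃++; ∈-++⁻; ∈-++⁺ˡ; ∈-++⁺ʳ; ∈-map⁺; ∈-map⁻; ∈-allFin; ∈-filter⁺; ∈-filter⁻; ∈-upTo⁺; ∈-upTo⁻)
open import Data.List.Relation.Binary.Subset.Propositional using (_⊆_)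
open import Data.List.Relation.Unary.All using (All; []; _∷_) renaming (lookup to All-lookup)
open import Data.List.Relation.Unary.All.Properties using (++⁺; ++⁻ˡ; ++⁻ʳ; ¬Any⇒All¬)
open import Data.List.Relation.Unary.Any using (here; there)
open import Data.List.Relation.Unary.Unique.Propositional using (Unique; []; _∷_)
open import Data.List.Relation.Unary.Unique.Propositional.Properties using (filter⁺; allFin⁺)
open import Data.Product using (Σ; ∃; _×_; _,_; proj₁; proj₂)
open import Data.Sum using (_⊎_; inj₁; inj₂)
open import Data.Sum.Properties using (≡-dec; inj₁-injective; inj₂-injective)
open import Data.Unit using (⊤; tt)
open import Data.Empty using (⊥; ⊥-elim)
open import Function using (_∘_)
open import Function.Bundles using (mk⇔; Equivalence)
open import Relation.Nullary using (Dec; yes; no; ¬_; ¬?; _×-dec_)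
open import Relation.Binary.Definitions using (DecidableEquality; tri<; tri≈; tri>)
open import Relation.Binary.PropositionalEquality
  using (_≡_; _≢_; refl; sym; trans; cong; cong₂; subst; subst₂; module ≡-Reasoning)

+-tight : ∀ {a b c e} → a ≤ c → b ≤ e → a + b ≡ c + e → a ≡ c × b ≡ e
+-tight a≤c b≤e eq with m≤n⇒m<n∨m≡n a≤c
... | inj₁ a<c = ⊥-elim (<-irrefl eq (+-mono-<-≤ a<c b≤e))
... | inj₂ refl = refl , +-cancelˡ-≡ _ _ _ eq

module _ {A : Set} where

  ∑ : List A → (A → ℕ) → ℕ
  ∑ [] f = 0
  ∑ (x ∷ xs) f = f x + ∑ xs f

  ∑-++ : ∀ xs ys (f : A → ℕ) → ∑ (xs ++ ys) f ≡ ∑ xs f + ∑ ys f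
  ∑-++ [] ys f = refl
  ∑-++ (x ∷ xs) ys f = trans (cong (f x +_) (∑-++ xs ys f)) (sym (+-assoc (f x) _ _))

  ∑-remove : ∀ xs {t ys} (f : A → ℕ) → ∑ (xs ++ t ∷ ys) f ≡ f t + ∑ (xs ++ ys) f
  ∑-remove xs {t} {ys} f = begin
    ∑ (xs ++ t ∷ ys) f       ≡⟨ ∑-++ xs (t ∷ ys) f ⟩
    ∑ xs f + (f t + ∑ ys f)  ≡⟨ x∙yz≈y∙xz (∑ xs f) (f t) (∑ ys f) ⟩
    f t + (∑ xs f + ∑ ys f)  ≡⟨ cong (f t +_) (∑-++ xs ys f) ⟨
    f t + ∑ (xs ++ ys) f     ∎
    where open ≡-Reasoning

  ∑-+ : ∀ xs (f g : A → ℕ) → ∑ xs (λ x → f x + g x) ≡ ∑ xs f + ∑ xs g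
  ∑-+ [] f g = refl
  ∑-+ (x ∷ xs) f g = trans (cong (f x + g x +_) (∑-+ xs f g)) (interchange (f x) (g x) (∑ xs f) (∑ xs g))

  ∑-cong : ∀ xs {f g : A → ℕ} → (∀ x → f x ≡ g x) → ∑ xs f ≡ ∑ xs g
  ∑-cong [] f≡g = refl
  ∑-cong (x ∷ xs) f≡g = cong₂ _+_ (f≡g x) (∑-cong xs f≡g)

  ∑-mono : ∀ xs {f g : A → ℕ} → (∀ {x} → x ∈ xs → f x ≤ g x) → ∑ xs f ≤ ∑ xs g
  ∑-mono [] f≤g = z≤n
  ∑-mono (x ∷ xs) f≤g = +-mono-≤ (f≤g (here refl)) (∑-mono xs (λ x∈ → f≤g (there x∈)))

  ∑-zero : ∀ xs {f : A → ℕ} → (∀ {x} → x ∈ xs → f x ≡ 0) → ∑ xs f ≡ 0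
  ∑-zero [] _ = refl
  ∑-zero (x ∷ xs) f≡0 = cong₂ _+_ (f≡0 (here refl)) (∑-zero xs (λ x∈ → f≡0 (there x∈)))

  ∑-member : ∀ {xs} (f : A → ℕ) {x} → x ∈ xs → f x ≤ ∑ xs f
  ∑-member {y ∷ xs} f (here refl) = m≤m+n (f y) (∑ xs f)
  ∑-member {y ∷ xs} f (there x∈) = ≤-trans (∑-member f x∈) (m≤n+m (∑ xs f) (f y))

  ∑-tight : ∀ xs {f g : A → ℕ} → (∀ {x} → x ∈ xs → f x ≤ g x) → ∑ xs f ≡ ∑ xs g →
    ∀ {x} → x ∈ xs → f x ≡ g x
  ∑-tight (y ∷ xs) f≤g eq (here refl) = proj₁ (+-tight (f≤g (here refl)) (∑-mono xs (λ x∈ → f≤g (there x∈))) eq)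
  ∑-tight (y ∷ xs) f≤g eq (there x∈) =
    ∑-tight xs (λ x∈ → f≤g (there x∈)) (proj₂ (+-tight (f≤g (here refl)) (∑-mono xs (λ x∈ → f≤g (there x∈))) eq)) x∈

  ∑-positive : ∀ xs (f : A → ℕ) → 0 < ∑ xs f → ∃ λ x → x ∈ xs × 0 < f x
  ∑-positive (x ∷ xs) f pos with f x in fx≡
  ... | suc _ = x , here refl , subst (0 <_) (sym fx≡) (s≤s z≤n)
  ... | zero with ∑-positive xs f pos
  ...   | y , y∈ , fy>0 = y , there y∈ , fy>0

  ∑-indicator : ∀ {xs} (f : A → ℕ) → Unique xs → (∀ {x} → x ∈ xs → f x ≤ 1) →
    (∀ {x y} → x ∈ xs → y ∈ xs → 0 < f x → 0 < f y → x ≡ y) → ∑ xs f ≤ 1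
  ∑-indicator {[]} f _ _ _ = z≤n
  ∑-indicator {x ∷ xs} f (x∉xs ∷ u) f≤1 single with f x in fx≡
  ... | zero = ∑-indicator f u (λ y∈ → f≤1 (there y∈))
                 (λ y∈ z∈ → single (there y∈) (there z∈))
  ... | suc _ = +-mono-≤ (subst (_≤ 1) fx≡ (f≤1 (here refl))) (≤-reflexive (∑-zero xs vanish))
    where
      vanish : ∀ {y} → y ∈ xs → f y ≡ 0
      vanish {y} y∈ with f y in fy≡
      ... | zero = refl
      ... | suc _ = ⊥-elim (All-lookup x∉xs y∈
                      (single (here refl) (there y∈) (subst (0 <_) (sym fx≡) (s≤s z≤n))
                                                    (subst (0 <_) (sym fy≡) (s≤s z≤n))))

∑-swap : ∀ {A B : Set} xs ys (f : A → B → ℕ) →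
  ∑ xs (λ x → ∑ ys (f x)) ≡ ∑ ys (λ y → ∑ xs (λ x → f x y))
∑-swap [] ys f = sym (∑-zero ys (λ _ → refl))
∑-swap (x ∷ xs) ys f = trans (cong (∑ ys (f x) +_) (∑-swap xs ys f))
                             (sym (∑-+ ys (f x) (λ y → ∑ xs (λ x′ → f x′ y))))

module _ {A : Set} where

  length-remove : ∀ (xs : List A) {t ys} → length (xs ++ t ∷ ys) ≡ suc (length (xs ++ ys))
  length-remove xs {t} {ys} =
    trans (length-++ xs) (trans (+-suc (length xs) (length ys)) (cong suc (sym (length-++ xs))))

  ∈-remove : ∀ (xs : List A) {t ys x} → x ∈ xs ++ t ∷ ys → x ≢ t → x ∈ xs ++ ys
  ∈-remove xs x∈ x≢t with ∈-++⁻ xs x∈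
  ... | inj₁ x∈xs = ∈-++⁺ˡ x∈xs
  ... | inj₂ (here x≡t) = ⊥-elim (x≢t x≡t)
  ... | inj₂ (there x∈ys) = ∈-++⁺ʳ xs x∈ys

  unique-remove : ∀ (xs : List A) {t ys} → Unique (xs ++ t ∷ ys) → Unique (xs ++ ys)
  unique-remove [] (_ ∷ u) = u
  unique-remove (x ∷ xs) (x∉ ∷ u) = ++⁺ (++⁻ˡ xs x∉) (All-tail (++⁻ʳ xs x∉)) ∷ unique-remove xs u
    where
      All-tail : ∀ {P : A → Set} {t ys} → All P (t ∷ ys) → All P ys
      All-tail (_ ∷ ps) = ps

  unique-front : ∀ (xs : List A) {t ys} → Unique (xs ++ t ∷ ys) → Unique (t ∷ xs)
  unique-front [] _ = [] ∷ []
  unique-front (x ∷ xs) {t} (x∉ ∷ u) with unique-front xs u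
  ... | t∉xs ∷ uxs = (t≢x ∷ t∉xs) ∷ ++⁻ˡ xs x∉ ∷ uxs
    where
      t≢x : t ≢ x
      t≢x t≡x = All-lookup x∉ (∈-++⁺ʳ xs (here refl)) (sym t≡x)

  unique-⊆-length : ∀ {xs ys : List A} → Unique xs → xs ⊆ ys → length xs ≤ length ys
  unique-⊆-length {[]} _ _ = z≤n
  unique-⊆-length {x ∷ xs} (x∉ ∷ u) xs⊆ys with ∈-∃++ (xs⊆ys (here refl))
  ... | ys₁ , ys₂ , refl = subst (suc (length xs) ≤_) (sym (length-remove ys₁))
         (s≤s (unique-⊆-length u (λ y∈ → ∈-remove ys₁ (xs⊆ys (there y∈)) (λ y≡x → All-lookup x∉ y∈ (sym y≡x)))))

  drop-++ : ∀ q (xs ys : List A) → q ≤ length xs → drop q (xs ++ ys) ≡ drop q xs ++ ys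
  drop-++ zero xs ys _ = refl
  drop-++ (suc q) (x ∷ xs) ys (s≤s q≤) = drop-++ q xs ys q≤

  drop-length : ∀ (xs ys : List A) → drop (length xs) (xs ++ ys) ≡ ys
  drop-length [] ys = refl
  drop-length (x ∷ xs) ys = drop-length xs ys

  ≤-length-++ : ∀ (p : List A) {w n} → n ≤ length w → n ≤ length (p ++ w)
  ≤-length-++ p {w} n≤|w| = subst (_ ≤_) (sym (length-++ p)) (≤-trans n≤|w| (m≤n+m (length w) (length p)))

  element : ∀ {xs : List A} → 0 < length xs → ∃ λ x → x ∈ xs
  element {x ∷ _} _ = x , here refl

  find-split : ∀ {P : A → Set} → (∀ x → Dec (P x)) → ∀ xs →
    (∃ λ xs₁ → ∃ λ x → ∃ λ xs₂ → xs ≡ xs₁ ++ x ∷ xs₂ × P x) ⊎ (∀ {x} → x ∈ xs → ¬ P x)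
  find-split P? [] = inj₂ (λ ())
  find-split P? (x ∷ xs) with P? x | find-split P? xs
  ... | yes px | _ = inj₁ ([] , x , xs , refl , px)
  ... | no _ | inj₁ (xs₁ , y , xs₂ , refl , py) = inj₁ (x ∷ xs₁ , y , xs₂ , refl , py)
  ... | no ¬px | inj₂ none = inj₂ λ { (here refl) → ¬px ; (there y∈) → none y∈ }

𝟙 : ∀ {P : Set} → Dec P → ℕ
𝟙 (yes _) = 1
𝟙 (no _) = 0

𝟙-≤1 : ∀ {P : Set} (P? : Dec P) → 𝟙 P? ≤ 1
𝟙-≤1 (yes _) = ≤-refl
𝟙-≤1 (no _) = z≤n

𝟙-sound : ∀ {P : Set} (P? : Dec P) → 0 < 𝟙 P? → P
𝟙-sound (yes p) _ = p

𝟙-complete : ∀ {P : Set} (P? : Dec P) → P → 𝟙 P? ≡ 1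
𝟙-complete (yes _) _ = refl
𝟙-complete (no ¬p) p = ⊥-elim (¬p p)

𝟙-absent : ∀ {P : Set} (P? : Dec P) → ¬ P → 𝟙 P? ≡ 0
𝟙-absent (yes p) ¬p = ⊥-elim (¬p p)
𝟙-absent (no _) _ = refl

𝟙-mono : ∀ {P Q : Set} → (P → Q) → (P? : Dec P) (Q? : Dec Q) → 𝟙 P? ≤ 𝟙 Q?
𝟙-mono _ (no _) _ = z≤n
𝟙-mono P⇒Q (yes p) Q? = ≤-reflexive (sym (𝟙-complete Q? (P⇒Q p)))

module _ {A : Set} where

  count : ∀ {P : A → Set} → (∀ x → Dec (P x)) → List A → ℕ
  count P? xs = ∑ xs (λ x → 𝟙 (P? x))

  count-mono : ∀ {P Q : A → Set} (P? : ∀ x → Dec (P x)) (Q? : ∀ x → Dec (Q x)) →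
    (∀ {x} → P x → Q x) → ∀ xs → count P? xs ≤ count Q? xs
  count-mono P? Q? P⇒Q xs = ∑-mono xs (λ {x} _ → 𝟙-mono P⇒Q (P? x) (Q? x))

  length-filter≡count : ∀ {P : A → Set} (P? : ∀ x → Dec (P x)) xs → length (filter P? xs) ≡ count P? xs
  length-filter≡count P? [] = refl
  length-filter≡count P? (x ∷ xs) with P? x
  ... | yes _ = cong suc (length-filter≡count P? xs)
  ... | no _ = length-filter≡count P? xs

  count≤length : ∀ {P : A → Set} (P? : ∀ x → Dec (P x)) xs → count P? xs ≤ length xs
  count≤length P? xs = subst (_≤ length xs) (length-filter≡count P? xs) (length-filter P? xs)

  count-filter : ∀ {P Q : A → Set} (P? : ∀ x → Dec (P x)) (Q? : ∀ x → Dec (Q x)) →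
    (∀ {x} → P x → Q x) → ∀ xs → count P? (filter Q? xs) ≡ count P? xs
  count-filter P? Q? P⇒Q [] = refl
  count-filter P? Q? P⇒Q (x ∷ xs) with Q? x
  ... | yes _ = cong (𝟙 (P? x) +_) (count-filter P? Q? P⇒Q xs)
  ... | no ¬qx with P? x
  ...   | yes px = ⊥-elim (¬qx (P⇒Q px))
  ...   | no _ = count-filter P? Q? P⇒Q xs

  count≥2-avoid : ∀ {B : Set} {P : A → Set} (P? : ∀ x → Dec (P x)) → DecidableEquality B →
    (f : A → B) → (∀ {x y} → f x ≡ f y → x ≡ y) →
    ∀ {xs} → Unique xs → 2 ≤ count P? xs → ∀ u → ∃ λ t → t ∈ xs × P t × f t ≢ u
  count≥2-avoid {P = P} P? _≟_ f f-inj {xs} u-xs two u with find-split (λ t → P? t ×-dec ¬? (f t ≟ u)) xs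
  ... | inj₁ (xs₁ , t , xs₂ , refl , pt , ft≢u) = t , ∈-++⁺ʳ xs₁ (here refl) , pt , ft≢u
  ... | inj₂ none = ⊥-elim (<⇒≱ two (∑-indicator _ u-xs (λ {x} _ → 𝟙-≤1 (P? x))
          (λ x∈ y∈ px py → f-inj (trans (hits x∈ (𝟙-sound (P? _) px)) (sym (hits y∈ (𝟙-sound (P? _) py)))))))
    where
      hits : ∀ {t} → t ∈ xs → P t → f t ≡ u
      hits {t} t∈ pt with f t ≟ u
      ... | yes ft≡u = ft≡u
      ... | no ft≢u = ⊥-elim (none t∈ (pt , ft≢u))

module Cycles {V : Set} (_≟_ : DecidableEquality V) (_~_ : V → V → Set)
  (~-sym : ∀ {u v} → u ~ v → v ~ u) (~-irrefl : ∀ {v} → ¬ (v ~ v)) where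

  open import Data.List.Membership.DecPropositional _≟_ using (_∈?_)

  Path : List V → Set
  Path [] = ⊤
  Path (_ ∷ []) = ⊤
  Path (u ∷ v ∷ vs) = u ~ v × Path (v ∷ vs)

  GraphCycle : Set
  GraphCycle = Σ V λ v → Σ (List V) λ vs → 2 ≤ length vs × Unique (v ∷ vs) × Path (v ∷ (vs ++ [ v ]))

  path-prefix : ∀ xs {t ys} → Path (xs ++ t ∷ ys) → Path (xs ++ [ t ])
  path-prefix [] _ = tt
  path-prefix (x ∷ []) (x~t , _) = x~t , tt
  path-prefix (x ∷ y ∷ xs) (x~y , p) = x~y , path-prefix (y ∷ xs) p

  Branching : List V → Set
  Branching Vs = ∀ {v} u → v ∈ Vs → ∃ λ t → v ~ t × t ∈ Vs × t ≢ u

  -- A finite nonempty branching vertex set carries a cycle: walk without ever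
  -- stepping straight back until a vertex repeats (which happens by pigeonhole).
  branching⇒cycle : ∀ Vs → Branching Vs → ∀ {v} → v ∈ Vs → GraphCycle
  branching⇒cycle Vs next {v} v∈ with next v v∈
  ... | t , v~t , t∈ , t≢v =
    walk (length Vs) t v [] ((t≢v ∷ []) ∷ [] ∷ []) (~-sym v~t , tt)
         (λ { (here refl) → t∈ ; (there (here refl)) → v∈ })
         (m<m+n (length Vs) (s≤s z≤n))
    where
      -- The walk so far, most recent vertex first.
      walk : ∀ fuel x y rest → let vs = x ∷ y ∷ rest in
             Unique vs → Path vs → vs ⊆ Vs → length Vs < fuel + length vs → GraphCycle
      walk zero x y rest u-vs _ vs⊆ bound = ⊥-elim (<⇒≱ bound (unique-⊆-length u-vs vs⊆))
      walk (suc fuel) x y rest u-vs path vs⊆ bound with next y (vs⊆ (here refl))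
      ... | z , x~z , z∈ , z≢y with z ∈? (x ∷ y ∷ rest)
      ...   | no z∉ = walk fuel z x (y ∷ rest) (¬Any⇒All¬ _ z∉ ∷ u-vs) (~-sym x~z , path)
                (λ { (here refl) → z∈ ; (there w∈) → vs⊆ w∈ })
                (subst (length Vs <_) (sym (+-suc fuel _)) bound)
      ...   | yes (here refl) = ⊥-elim (~-irrefl x~z)
      ...   | yes (there (here refl)) = ⊥-elim (z≢y refl)
      ...   | yes (there (there z∈rest)) with ∈-∃++ z∈rest
      ...     | r₁ , r₂ , refl =
        z , x ∷ y ∷ r₁ , s≤s (s≤s z≤n) , unique-front (x ∷ y ∷ r₁) u-vs ,
        (~-sym x~z , path-prefix (x ∷ y ∷ r₁) path)

pred[m+n]≤m+pred[n] : ∀ i x → pred (i + x) ≤ i + pred x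
pred[m+n]≤m+pred[n] i zero = pred[n]≤n
pred[m+n]≤m+pred[n] i (suc x) = ≤-reflexive (cong pred (+-suc i x))

module BipartiteForest {A B : Set} (_≟A_ : DecidableEquality A) (_≟B_ : DecidableEquality B)
  (E : A → B → Set) (E? : ∀ a b → Dec (E a b)) where

  _~_ : A ⊎ B → A ⊎ B → Set
  inj₁ a ~ inj₂ b = E a b
  inj₂ b ~ inj₁ a = E a b
  inj₁ _ ~ inj₁ _ = ⊥
  inj₂ _ ~ inj₂ _ = ⊥

  ~-sym : ∀ {u v} → u ~ v → v ~ u
  ~-sym {inj₁ _} {inj₂ _} e = e
  ~-sym {inj₂ _} {inj₁ _} e = e

  ~-irrefl : ∀ {v} → ¬ (v ~ v)
  ~-irrefl {inj₁ _} ()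
  ~-irrefl {inj₂ _} ()

  open Cycles (≡-dec _≟A_ _≟B_) _~_ (λ {u v} → ~-sym {u} {v}) (λ {v} → ~-irrefl {v}) public

  deg : List A → B → ℕ
  deg L b = count (λ a → E? a b) L

  nbrs : List B → A → ℕ
  nbrs R a = count (E? a) R

  remove-left : ∀ L₁ {a L₂} R → ∑ R (λ b → pred (deg (L₁ ++ a ∷ L₂) b)) ≤ nbrs R a + ∑ R (λ b → pred (deg (L₁ ++ L₂) b))
  remove-left L₁ {a} {L₂} R = begin
    ∑ R (λ b → pred (deg (L₁ ++ a ∷ L₂) b))      ≡⟨ ∑-cong R (λ b → cong pred (∑-remove L₁ (λ a′ → 𝟙 (E? a′ b)))) ⟩
    ∑ R (λ b → pred (𝟙 (E? a b) + deg L′ b))     ≤⟨ ∑-mono R (λ {b} _ → pred[m+n]≤m+pred[n] (𝟙 (E? a b)) (deg L′ b)) ⟩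
    ∑ R (λ b → 𝟙 (E? a b) + pred (deg L′ b))     ≡⟨ ∑-+ R (λ b → 𝟙 (E? a b)) (λ b → pred (deg L′ b)) ⟩
    nbrs R a + ∑ R (λ b → pred (deg L′ b))       ∎
    where
      open ≤-Reasoning
      L′ : List A
      L′ = L₁ ++ L₂

  remove-right : ∀ L R₁ {c R₂} → deg L c ≤ 1 →
    ∑ (R₁ ++ c ∷ R₂) (λ b → pred (deg L b)) ≡ ∑ (R₁ ++ R₂) (λ b → pred (deg L b))
  remove-right L R₁ {c} {R₂} deg≤1 =
    trans (∑-remove R₁ (λ b → pred (deg L b))) (cong (_+ ∑ (R₁ ++ R₂) (λ b → pred (deg L b))) (m≤n⇒m∸n≡0 deg≤1))

  leafless⇒cycle : ∀ {L R} → Unique L → Unique R →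
    (∀ {a} → a ∈ L → 2 ≤ nbrs R a) → (∀ {b} → b ∈ R → 2 ≤ deg L b) → ∀ {a} → a ∈ L → GraphCycle
  leafless⇒cycle {L} {R} u-L u-R left-branching right-branching a∈L =
    branching⇒cycle Vs next (∈-++⁺ˡ (∈-map⁺ inj₁ a∈L))
    where
      Vs : List (A ⊎ B)
      Vs = map inj₁ L ++ map inj₂ R
      next : Branching Vs
      next u v∈ with ∈-++⁻ (map inj₁ L) v∈
      ... | inj₁ v∈L with ∈-map⁻ inj₁ v∈L
      ...   | a , a∈L , refl with count≥2-avoid (E? a) (≡-dec _≟A_ _≟B_) inj₂ inj₂-injective u-R (left-branching a∈L) u
      ...     | b , b∈R , e , b≢u = inj₂ b , e , ∈-++⁺ʳ (map inj₁ L) (∈-map⁺ inj₂ b∈R) , b≢u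
      next u v∈ | inj₂ v∈R with ∈-map⁻ inj₂ v∈R
      ...   | b , b∈R , refl with count≥2-avoid (λ a → E? a b) (≡-dec _≟A_ _≟B_) inj₁ inj₁-injective u-L (right-branching b∈R) u
      ...     | a , a∈L , e , a≢u = inj₁ a , e , ∈-++⁺ˡ (∈-map⁺ inj₁ a∈L) , a≢u

  -- Forest inequality: if the graph has no cycle, then for repetition-free
  -- lists L and R we have Σ_{b ∈ R} (deg_L b − 1) ≤ |L| − 1. By induction on
  -- |L| + |R|: delete a vertex with at most one neighbour; if there is none,
  -- the graph has a cycle.
  forest-inequality : ¬ GraphCycle → ∀ {L R} → Unique L → Unique R →
    ∑ R (λ b → pred (deg L b)) ≤ pred (length L)
  forest-inequality acyclic {L} {R} = bound (suc (length L + length R)) L R ≤-refl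
    where
      bound : ∀ n L R → length L + length R < n → Unique L → Unique R →
        ∑ R (λ b → pred (deg L b)) ≤ pred (length L)
      bound (suc n) L R size u-L u-R with length L ≤? 1
      ... | yes |L|≤1 = ≤-trans (≤-reflexive (∑-zero R (λ {b} _ →
                          m≤n⇒m∸n≡0 (≤-trans (count≤length (λ a → E? a b) L) |L|≤1)))) z≤n
      ... | no 1<|L| with find-split (λ b → deg L b ≤? 1) R
      ...   | inj₁ (R₁ , c , R₂ , refl , deg≤1) =
                subst (_≤ pred (length L)) (sym (remove-right L R₁ deg≤1))
                  (bound n L (R₁ ++ R₂) size′ u-L (unique-remove R₁ u-R))
        where
          size′ : length L + length (R₁ ++ R₂) < n
          size′ = subst (_≤ n) (trans (cong (length L +_) (length-remove R₁)) (+-suc (length L) _)) (s≤s⁻¹ size)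
      ...   | inj₂ no-right-leaf with find-split (λ a → nbrs R a ≤? 1) L
      ...     | inj₁ (L₁ , a , L₂ , refl , nbrs≤1) = begin
                ∑ R (λ b → pred (deg (L₁ ++ a ∷ L₂) b))  ≤⟨ remove-left L₁ R ⟩
                nbrs R a + ∑ R (λ b → pred (deg L′ b))   ≤⟨ +-mono-≤ nbrs≤1 (bound n L′ R size′ (unique-remove L₁ u-L) u-R) ⟩
                suc (pred (length L′))                   ≡⟨ suc-pred (length L′) {{>-nonZero L′-nonempty}} ⟩
                length L′                                ≡⟨ cong pred (length-remove L₁) ⟨
                pred (length (L₁ ++ a ∷ L₂))             ∎
        where
          open ≤-Reasoning
          L′ : List A
          L′ = L₁ ++ L₂
          L′-nonempty : 0 < length L′
          L′-nonempty = s≤s⁻¹ (subst (1 <_) (length-remove L₁) (≰⇒> 1<|L|))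
          size′ : length L′ + length R < n
          size′ = subst (_≤ n) (cong (_+ length R) (length-remove L₁)) (s≤s⁻¹ size)
      ...     | inj₂ no-left-leaf with element {xs = L} (≤-trans (s≤s z≤n) (≰⇒> 1<|L|))
      ...       | a , a∈L = ⊥-elim (acyclic (leafless⇒cycle u-L u-R
                              (λ a∈ → ≰⇒> (no-left-leaf a∈)) (λ b∈ → ≰⇒> (no-right-leaf b∈)) a∈L))

-- ψ n = 2n − 1 for n ≥ 1 and ψ 0 = 0. It is superadditive, and strictly so on
-- pairs of positive numbers: splitting a positive quantity into two positive
-- parts strictly lowers its ψ-weight.
ψ : ℕ → ℕ
ψ n = n + pred n

ψ-mono : ∀ {m n} → m ≤ n → ψ m ≤ ψ n
ψ-mono m≤n = +-mono-≤ m≤n (pred-mono-≤ m≤n)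

ψ-mono-< : ∀ {m n} → m < n → ψ m < ψ n
ψ-mono-< m<n = +-mono-<-≤ m<n (pred-mono-≤ (<⇒≤ m<n))

ψ-injective : ∀ {m n} → ψ m ≡ ψ n → m ≡ n
ψ-injective {m} {n} eq with <-cmp m n
... | tri< m<n _ _ = ⊥-elim (<-irrefl eq (ψ-mono-< m<n))
... | tri≈ _ m≡n _ = m≡n
... | tri> _ _ n<m = ⊥-elim (<-irrefl (sym eq) (ψ-mono-< n<m))

ψ-split : ∀ m n → ψ m + ψ n ≡ (m + n) + (pred m + pred n)
ψ-split m n = interchange m (pred m) n (pred n)

pred[m]+pred[n]≤pred[m+n] : ∀ m n → pred m + pred n ≤ pred (m + n)
pred[m]+pred[n]≤pred[m+n] zero n = ≤-refl
pred[m]+pred[n]≤pred[m+n] (suc m) zero = ≤-refl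
pred[m]+pred[n]≤pred[m+n] (suc m) (suc n) = +-monoʳ-≤ m (n≤1+n n)

pred[m]+pred[n]<pred[m+n] : ∀ {m n} → 0 < m → 0 < n → pred m + pred n < pred (m + n)
pred[m]+pred[n]<pred[m+n] {suc m} {suc n} _ _ = ≤-reflexive (sym (+-suc m n))

ψ-superadditive : ∀ m n → ψ m + ψ n ≤ ψ (m + n)
ψ-superadditive m n rewrite ψ-split m n = +-monoʳ-≤ (m + n) (pred[m]+pred[n]≤pred[m+n] m n)

ψ-strict : ∀ {m n} → 0 < m → 0 < n → ψ m + ψ n < ψ (m + n)
ψ-strict {m} {n} m>0 n>0 rewrite ψ-split m n = +-monoʳ-< (m + n) (pred[m]+pred[n]<pred[m+n] m>0 n>0)

module _ {A : Set} where

  ∑ψ≤ψ∑ : ∀ xs (h : A → ℕ) → ∑ xs (λ x → ψ (h x)) ≤ ψ (∑ xs h)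
  ∑ψ≤ψ∑ [] h = ≤-refl
  ∑ψ≤ψ∑ (x ∷ xs) h = ≤-trans (+-monoʳ-≤ (ψ (h x)) (∑ψ≤ψ∑ xs h)) (ψ-superadditive (h x) (∑ xs h))

  concentration : ∀ xs (h : A → ℕ) → 0 < ∑ xs h → ψ (∑ xs h) ≤ ∑ xs (λ x → ψ (h x)) →
    ∃ λ b → b ∈ xs × h b ≡ ∑ xs h × (∀ {c} → c ∈ xs → 0 < h c → c ≡ b)
  concentration (x ∷ xs) h total>0 attained with h x in hx≡ | ∑ xs h in S≡
  ... | zero | _ with concentration xs h (subst (0 <_) (sym S≡) total>0)
                        (subst (λ S → ψ S ≤ ∑ xs (λ x → ψ (h x))) (sym S≡) attained)
  ...   | b , b∈ , hb≡ , only-b = b , there b∈ , trans hb≡ S≡ , λ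
          { (here refl) hx>0 → ⊥-elim (<-irrefl (sym hx≡) hx>0)
          ; (there c∈) hc>0 → only-b c∈ hc>0 }
  concentration (x ∷ xs) h total>0 attained | suc k | zero =
    x , here refl , trans hx≡ (sym (+-identityʳ (suc k))) , λ
      { (here refl) _ → refl
      ; (there c∈) hc>0 → ⊥-elim (<-irrefl (sym S≡) (≤-trans hc>0 (∑-member h c∈))) }
  concentration (x ∷ xs) h total>0 attained | suc k | suc j =
    ⊥-elim (<⇒≱ (ψ-strict {suc k} {suc j} (s≤s z≤n) (s≤s z≤n)) (begin
      ψ (suc k + suc j)                        ≤⟨ attained ⟩
      ψ (suc k) + ∑ xs (λ x → ψ (h x))         ≤⟨ +-monoʳ-≤ (ψ (suc k)) (∑ψ≤ψ∑ xs h) ⟩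
      ψ (suc k) + ψ (∑ xs h)                   ≡⟨ cong (λ S → ψ (suc k) + ψ S) S≡ ⟩
      ψ (suc k) + ψ (suc j)                    ∎))
    where open ≤-Reasoning

-- Classically, a sequence of naturals that never increases from index m on is
-- eventually constant: it can only drop finitely many times.
eventually-constant : Classical → (f : ℕ → ℕ) (m : ℕ) → (∀ n → m ≤ n → f (suc n) ≤ f n) →
  ∃ λ N → m ≤ N × (∀ n → N ≤ n → f (suc n) ≡ f n)
eventually-constant em f m non-increasing = descend (f m) m ≤-refl ≤-refl
  where
    settle : ∀ {N n} → m ≤ N → N ≤′ n → f n ≤ f N
    settle _ ≤′-refl = ≤-refl
    settle m≤N (≤′-step N≤′n) = ≤-trans (non-increasing _ (≤-trans m≤N (≤′⇒≤ N≤′n))) (settle m≤N N≤′n)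

    -- v bounds the value f N; each further drop lowers the bound.
    descend : ∀ v N → m ≤ N → f N ≤ v → ∃ λ N → m ≤ N × (∀ n → N ≤ n → f (suc n) ≡ f n)
    descend v N m≤N fN≤v with em (∃ λ n → N ≤ n × f n < f N)
    ... | no never-drops = N , m≤N , λ n N≤n → trans (constant (≤-trans N≤n (n≤1+n n))) (sym (constant N≤n))
      where
        constant : ∀ {n} → N ≤ n → f n ≡ f N
        constant {n} N≤n = ≤-antisym (settle m≤N (≤⇒≤′ N≤n)) (≮⇒≥ (λ fn<fN → never-drops (n , N≤n , fn<fN)))
    descend zero N m≤N fN≤v | yes (n , _ , fn<fN) = ⊥-elim (n≮0 (≤-trans fn<fN fN≤v))
    descend (suc v) N m≤N fN≤v | yes (n , N≤n , fn<fN) =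
      descend v n (≤-trans m≤N N≤n) (s≤s⁻¹ (≤-trans fn<fN fN≤v))

module WordSums {d : ℕ} where

  letters : List (Fin d)
  letters = allFin d

  ∑W : ℕ → (Word d → ℕ) → ℕ
  ∑W zero f = f []
  ∑W (suc n) f = ∑W n (λ w → ∑ letters (λ b → f (w ++ [ b ])))

  length-∷ʳ : ∀ (w : Word d) b {n} → length w ≡ n → length (w ++ [ b ]) ≡ suc n
  length-∷ʳ w b |w|≡n = trans (length-++ w) (trans (+-comm (length w) 1) (cong suc |w|≡n))

  extension-≤ : ∀ {n} {f g : Word d → ℕ} → (∀ w → length w ≡ suc n → f w ≤ g w) →
    ∀ u → length u ≡ n → ∀ {c} → c ∈ letters → f (u ++ [ c ]) ≤ g (u ++ [ c ])
  extension-≤ f≤g u |u|≡n {c} _ = f≤g (u ++ [ c ]) (length-∷ʳ u c |u|≡n)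

  ∑W-mono : ∀ n {f g : Word d → ℕ} → (∀ w → length w ≡ n → f w ≤ g w) → ∑W n f ≤ ∑W n g
  ∑W-mono zero f≤g = f≤g [] refl
  ∑W-mono (suc n) f≤g = ∑W-mono n (λ u |u|≡n → ∑-mono letters (extension-≤ f≤g u |u|≡n))

  ∑W-tight : ∀ n {f g : Word d → ℕ} → (∀ w → length w ≡ n → f w ≤ g w) → ∑W n f ≡ ∑W n g →
    ∀ w → length w ≡ n → f w ≡ g w
  ∑W-tight zero f≤g eq [] _ = eq
  ∑W-tight (suc n) f≤g eq w |w|≡ with initLast w
  ... | v ∷ʳ′ b =
    ∑-tight letters (extension-≤ f≤g v |v|≡n)
      (∑W-tight n (λ u |u|≡n → ∑-mono letters (extension-≤ f≤g u |u|≡n)) eq v |v|≡n) (∈-allFin b)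
    where
      |v|≡n : length v ≡ n
      |v|≡n = suc-injective (trans (sym (length-∷ʳ v b refl)) |w|≡)

  -- A word functional Q that never increases along one-letter right extensions
  -- of words of length ≥ M is, from some length N on, exactly conserved by them:
  -- the level sums ∑W n Q are eventually constant, which forces equality word by word.
  eventually-conserved : Classical → (Q : Word d → ℕ) (M : ℕ) →
    (∀ w → M ≤ length w → ∑ letters (λ b → Q (w ++ [ b ])) ≤ Q w) →
    ∃ λ N → M ≤ N × (∀ w → N ≤ length w → ∑ letters (λ b → Q (w ++ [ b ])) ≡ Q w)
  eventually-conserved em Q M non-increasing with eventually-constant em (λ n → ∑W n Q) M level-drops
    where
      level-drops : ∀ n → M ≤ n → ∑W (suc n) Q ≤ ∑W n Q
      level-drops n M≤n = ∑W-mono n (λ w |w|≡n → non-increasing w (subst (M ≤_) (sym |w|≡n) M≤n))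
  ... | N , M≤N , stable = N , M≤N , λ w N≤|w| →
    ∑W-tight (length w) (λ u |u|≡ → non-increasing u (≤-trans M≤N (subst (N ≤_) (sym |u|≡) N≤|w|)))
      (stable (length w) N≤|w|) w refl

HasCard-unique : ∀ {d} {P : Fin d → Set} {m n} → HasCard P m → HasCard P n → m ≡ n
HasCard-unique (as , refl , u-as , as-iff) (bs , refl , u-bs , bs-iff) =
  ≤-antisym (unique-⊆-length u-as (λ {a} a∈ → Equivalence.to (bs-iff a) (Equivalence.from (as-iff a) a∈)))
            (unique-⊆-length u-bs (λ {a} a∈ → Equivalence.to (as-iff a) (Equivalence.from (bs-iff a) a∈)))

ℒ-prefix : ∀ {d} (X : Config d → Set) (u v : Word d) → ℒ X (u ++ v) → ℒ X u
ℒ-prefix X u v (x , x∈X , i , occ) = x , x∈X , i , occurs-prefix u occ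
  where
    occurs-prefix : ∀ u {x i} → OccursAt x i (u ++ v) → OccursAt x i u
    occurs-prefix [] _ = tt
    occurs-prefix (a ∷ u) (xᵢ≡a , occ) = xᵢ≡a , occurs-prefix u occ

ℒ-suffix : ∀ {d} (X : Config d → Set) a (u : Word d) → ℒ X (a ∷ u) → ℒ X u
ℒ-suffix X a u (x , x∈X , i , (_ , occ)) = x , x∈X , _ , occ

module Multiplicity (em : Classical) {d : ℕ} (X : Config d → Set) where

  open WordSums {d} public

  L₁? : ∀ w a → Dec (L₁ X w a)
  L₁? w a = em (L₁ X w a)

  leftExt : Word d → List (Fin d)
  leftExt w = filter (L₁? w) letters

  ℓ : Word d → ℕ
  ℓ w = count (L₁? w) letters

  ℓ-card : ∀ w → ℓ≡ X w (ℓ w)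
  ℓ-card w = leftExt w , length-filter≡count (L₁? w) letters , filter⁺ (L₁? w) (allFin⁺ d) ,
    λ a → mk⇔ (∈-filter⁺ (L₁? w) (∈-allFin a)) (λ a∈ → proj₂ (∈-filter⁻ (L₁? w) {xs = letters} a∈))

  special⇒ : ∀ {w} → LeftSpecial X w → 2 ≤ ℓ w
  special⇒ {w} (n , card , 1<n) = subst (2 ≤_) (HasCard-unique card (ℓ-card w)) 1<n

  ⇒special : ∀ {w} → 2 ≤ ℓ w → LeftSpecial X w
  ⇒special {w} 2≤ℓ = ℓ w , ℓ-card w , 2≤ℓ

  ℓ-∷ʳ : ∀ w b → ℓ (w ++ [ b ]) ≤ ℓ w
  ℓ-∷ʳ w b = count-mono (L₁? (w ++ [ b ])) (L₁? w) (λ {a} → ℒ-prefix X (a ∷ w) [ b ]) letters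

  module _ (w : Word d) where

    open BipartiteForest _≟ᶠ_ _≟ᶠ_ (λ a b → ℒ X (a ∷ (w ++ [ b ]))) (λ a b → em _)
      using (forest-inequality; _~_; Path; GraphCycle)

    private
      adjacent : ∀ {u v} → u ~ v → Adj X w u v
      adjacent {inj₁ _} {inj₂ _} e = e
      adjacent {inj₂ _} {inj₁ _} e = e

      chain : ∀ vs → Path vs → Chain X w vs
      chain [] _ = tt
      chain (_ ∷ []) _ = tt
      chain (_ ∷ _ ∷ vs) (e , path) = adjacent e , chain (_ ∷ vs) path

      cycle : GraphCycle → Cycle X w
      cycle (v , vs , long , u , path) = v , vs , long , u , chain (v ∷ (vs ++ [ v ])) path

    ℓ-forest : ¬ Cycle X w → ∑ letters (λ b → pred (ℓ (w ++ [ b ]))) ≤ pred (ℓ w)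
    ℓ-forest acyclic = subst₂ _≤_
      (∑-cong letters (λ b → cong pred (count-filter (λ a → em _) (L₁? w) (λ {a} → ℒ-prefix X (a ∷ w) [ b ]) letters)))
      (cong pred (length-filter≡count (L₁? w) letters))
      (forest-inequality (λ c → acyclic (cycle c)) (filter⁺ (L₁? w) (allFin⁺ d)) (allFin⁺ d))

module EventuallyDendricShift (em : Classical) {d : ℕ} (X : Config d → Set) (m : ℕ)
  (dendric : ∀ w → ℒ X w → m ≤ length w → IsTree X w) where

  open Multiplicity em X

  -- Long words have acyclic extension graphs (words outside ℒ(X) have no edges at all).
  acyclic : ∀ w → m ≤ length w → ¬ Cycle X w
  acyclic w m≤|w| with em (ℒ X w)
  ... | yes w∈ℒ = proj₂ (dendric w w∈ℒ m≤|w|)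
  ... | no w∉ℒ = λ { (_ , [] , () , _) ; (v , v₁ ∷ _ , _ , _ , (edge , _)) → w∉ℒ (edge-word v v₁ edge) }
    where
      edge-word : ∀ u v → Adj X w u v → ℒ X w
      edge-word (inj₁ a) (inj₂ b) awb = ℒ-prefix X w [ b ] (ℒ-suffix X a (w ++ [ b ]) awb)
      edge-word (inj₂ b) (inj₁ a) awb = ℒ-prefix X w [ b ] (ℒ-suffix X a (w ++ [ b ]) awb)

  excess : Word d → ℕ
  excess w = pred (ℓ w)

  φ : Word d → ℕ
  φ w = ψ (excess w)

  -- By the forest inequality and superadditivity of ψ, the potential does not
  -- grow along right extensions of long words.
  φ-non-increasing : ∀ w → m ≤ length w → ∑ letters (λ b → φ (w ++ [ b ])) ≤ φ w
  φ-non-increasing w m≤|w| =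
    ≤-trans (∑ψ≤ψ∑ letters (λ b → excess (w ++ [ b ]))) (ψ-mono (ℓ-forest w (acyclic w m≤|w|)))

  private
    phase₁ : ∃ λ N → m ≤ N × (∀ w → N ≤ length w → ∑ letters (λ b → φ (w ++ [ b ])) ≡ φ w)
    phase₁ = eventually-conserved em φ m φ-non-increasing

  N₁ : ℕ
  N₁ = proj₁ phase₁

  φ-conserved : ∀ w → N₁ ≤ length w → ∑ letters (λ b → φ (w ++ [ b ])) ≡ φ w
  φ-conserved = proj₂ (proj₂ phase₁)

  m≤N₁ : m ≤ N₁
  m≤N₁ = proj₁ (proj₂ phase₁)

  record UniqueSpecialExtension (w : Word d) : Set where
    field
      letter : Fin d
      keeps-ℓ : ℓ (w ++ [ letter ]) ≡ ℓ w
      only : ∀ c → 2 ≤ ℓ (w ++ [ c ]) → c ≡ letter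

  -- Every left-special word of length ≥ N₁ has a unique left-special extension:
  -- conservation of the potential forces the forest inequality to be tight and
  -- concentrated on a single letter.
  special-extension : ∀ w → N₁ ≤ length w → 2 ≤ ℓ w → UniqueSpecialExtension w
  special-extension w N₁≤|w| 2≤ℓw =
    concentrated (concentration letters h (subst (0 <_) (sym total) (pred-mono-≤ 2≤ℓw)) attained)
    where
      h : Fin d → ℕ
      h b = excess (w ++ [ b ])

      nonzero : ∀ u → 0 < excess u → NonZero (ℓ u)
      nonzero u excess>0 = >-nonZero (≤-trans excess>0 pred[n]≤n)

      conserved : ∑ letters (λ b → ψ (h b)) ≡ ψ (excess w)
      conserved = φ-conserved w N₁≤|w|

      total : ∑ letters h ≡ excess w
      total = ψ-injective (≤-antisym (ψ-mono (ℓ-forest w (acyclic w (≤-trans m≤N₁ N₁≤|w|))))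
                (subst (_≤ ψ (∑ letters h)) conserved (∑ψ≤ψ∑ letters h)))

      attained : ψ (∑ letters h) ≤ ∑ letters (λ b → ψ (h b))
      attained = ≤-reflexive (trans (cong ψ total) (sym conserved))

      concentrated : (∃ λ b → b ∈ letters × h b ≡ ∑ letters h × (∀ {c} → c ∈ letters → 0 < h c → c ≡ b)) →
        UniqueSpecialExtension w
      concentrated (b , _ , hb≡ , only-b) = record
        { letter = b
        ; keeps-ℓ = pred-injective {{nonzero (w ++ [ b ]) hb>0}} {{nonzero w (pred-mono-≤ 2≤ℓw)}} (trans hb≡ total)
        ; only = λ c 2≤ℓwc → only-b (∈-allFin c) (pred-mono-≤ 2≤ℓwc)
        }
        where
          hb>0 : 0 < h b
          hb>0 = subst (0 <_) (sym (trans hb≡ total)) (pred-mono-≤ 2≤ℓw)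

  continuation : ∀ u b → N₁ ≤ length u → LeftSpecial X u → 2 ≤ ℓ (u ++ [ b ]) →
    (LeftSpecial X (u ++ [ b ]) × (∀ c → LeftSpecial X (u ++ [ c ]) → c ≡ b))
    × (∃ λ n → ℓ≡ X (u ++ [ b ]) n × ℓ≡ X u n)
  continuation u b N₁≤|u| u-special 2≤ℓub =
    (⇒special 2≤ℓub , λ c uc-special → trans (only c (special⇒ uc-special)) (sym b≡letter)) ,
    (ℓ u , subst (ℓ≡ X (u ++ [ b ])) ℓ-kept (ℓ-card (u ++ [ b ])) , ℓ-card u)
    where
      open UniqueSpecialExtension (special-extension u N₁≤|u| (special⇒ u-special))
      b≡letter : b ≡ letter
      b≡letter = only b 2≤ℓub
      ℓ-kept : ℓ (u ++ [ b ]) ≡ ℓ u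
      ℓ-kept = trans (cong (λ c → ℓ (u ++ [ c ])) b≡letter) keeps-ℓ

  module JointExtension (k : ℕ) where

    Both : ℕ → Word d → Set
    Both q x = 2 ≤ ℓ x × 2 ≤ ℓ (drop q x)

    χ : ℕ → Word d → ℕ
    χ q x = 𝟙 (em (Both q x))

    both-∷ʳ : ∀ q x b → q ≤ length x → Both q (x ++ [ b ]) → Both q x
    both-∷ʳ q x b q≤|x| (xb-special , suffix-special) =
      ≤-trans xb-special (ℓ-∷ʳ x b) ,
      ≤-trans (subst (λ u → 2 ≤ ℓ u) (drop-++ q x [ b ] q≤|x|) suffix-special) (ℓ-∷ʳ (drop q x) b)

    -- Since x has only one left-special right extension, at most one letter keeps Both.
    χ-non-increasing : ∀ q x → q ≤ length x → N₁ ≤ length x → ∑ letters (λ b → χ q (x ++ [ b ])) ≤ χ q x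
    χ-non-increasing q x q≤|x| N₁≤|x| with em (Both q x)
    ... | no ¬both = ≤-reflexive (∑-zero letters (λ {b} _ → 𝟙-absent (em _) (¬both ∘ both-∷ʳ q x b q≤|x|)))
    ... | yes (x-special , _) = ∑-indicator _ (allFin⁺ d) (λ _ → 𝟙-≤1 (em _))
            (λ {b} {c} _ _ χb>0 χc>0 → trans (only b (proj₁ (𝟙-sound (em _) χb>0)))
                                             (sym (only c (proj₁ (𝟙-sound (em _) χc>0)))))
      where open UniqueSpecialExtension (special-extension x N₁≤|x| x-special)

    Q : Word d → ℕ
    Q x = ∑ (upTo (suc k)) (λ q → χ q x)

    χ-non-increasing-≤k : ∀ x → k + N₁ ≤ length x → ∀ {q} → q ∈ upTo (suc k) →
      ∑ letters (λ b → χ q (x ++ [ b ])) ≤ χ q x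
    χ-non-increasing-≤k x k+N₁≤|x| q∈ =
      χ-non-increasing _ x (≤-trans (s≤s⁻¹ (∈-upTo⁻ q∈)) (≤-trans (m≤m+n k N₁) k+N₁≤|x|))
                           (≤-trans (m≤n+m N₁ k) k+N₁≤|x|)

    Q-non-increasing : ∀ x → k + N₁ ≤ length x → ∑ letters (λ b → Q (x ++ [ b ])) ≤ Q x
    Q-non-increasing x k+N₁≤|x| =
      ≤-trans (≤-reflexive (∑-swap letters (upTo (suc k)) (λ b q → χ q (x ++ [ b ]))))
              (∑-mono (upTo (suc k)) (χ-non-increasing-≤k x k+N₁≤|x|))

    private
      phase₂ : ∃ λ N → k + N₁ ≤ N × (∀ x → N ≤ length x → ∑ letters (λ b → Q (x ++ [ b ])) ≡ Q x)
      phase₂ = eventually-conserved em Q (k + N₁) Q-non-increasing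

    N₂ : ℕ
    N₂ = proj₁ phase₂

    N₁≤N₂ : N₁ ≤ N₂
    N₁≤N₂ = ≤-trans (m≤n+m N₁ k) (proj₁ (proj₂ phase₂))

    χ-conserved : ∀ q x → q ≤ k → N₂ ≤ length x → ∑ letters (λ b → χ q (x ++ [ b ])) ≡ χ q x
    χ-conserved q x q≤k N₂≤|x| =
      ∑-tight (upTo (suc k)) (χ-non-increasing-≤k x (≤-trans (proj₁ (proj₂ phase₂)) N₂≤|x|))
        (trans (sym (∑-swap letters (upTo (suc k)) (λ b q → χ q (x ++ [ b ])))) (proj₂ (proj₂ phase₂) x N₂≤|x|))
        (∈-upTo⁺ (s≤s q≤k))

    common-extension : ∀ p w → length p ≤ k → N₂ ≤ length w → 2 ≤ ℓ (p ++ w) → 2 ≤ ℓ w →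
      ∃ λ b → 2 ≤ ℓ ((p ++ w) ++ [ b ]) × 2 ≤ ℓ (w ++ [ b ])
    common-extension p w |p|≤k N₂≤|w| pw-special w-special =
      joint (∑-positive letters (λ b → χ (length p) ((p ++ w) ++ [ b ])) extensions>0)
      where
        extensions>0 : 0 < ∑ letters (λ b → χ (length p) ((p ++ w) ++ [ b ]))
        extensions>0 = subst (0 <_) (sym (trans (χ-conserved (length p) (p ++ w) |p|≤k (≤-length-++ p N₂≤|w|))
          (𝟙-complete (em _) (pw-special , subst (λ u → 2 ≤ ℓ u) (sym (drop-length p w)) w-special))))
          (s≤s z≤n)

        suffix : ∀ b → drop (length p) ((p ++ w) ++ [ b ]) ≡ w ++ [ b ]
        suffix b = trans (cong (drop (length p)) (++-assoc p w [ b ])) (drop-length p (w ++ [ b ]))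

        joint : (∃ λ b → b ∈ letters × 0 < χ (length p) ((p ++ w) ++ [ b ])) →
          ∃ λ b → 2 ≤ ℓ ((p ++ w) ++ [ b ]) × 2 ≤ ℓ (w ++ [ b ])
        joint (b , _ , χb>0) with 𝟙-sound (em _) χb>0
        ... | pwb-special , suffix-special = b , pwb-special , subst (λ u → 2 ≤ ℓ u) (suffix b) suffix-special

-- Lemma 5.2, with n = N₂ + 1: common-extension provides b, and continuation
-- applied to w and to pw gives uniqueness of b and the equalities of ℓ.
lemma5p2 : Classical → (d : ℕ) (X : Config d → Set) → IsShiftSpace X → EventuallyDendric X →
    ∀ (k : ℕ) → 1 ≤ k → ∃ λ (n : ℕ) → 1 ≤ n ×
      (∀ (p w : Word d) → ℒ X p → ℒ X w → length p ≤ k → n ≤ length w →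
        LeftSpecial X (p ++ w) → LeftSpecial X w →
        ∃ λ (b : Fin d) →
          (LeftSpecial X (w ++ [ b ]) × (∀ c → LeftSpecial X (w ++ [ c ]) → c ≡ b))
          × (LeftSpecial X ((p ++ w) ++ [ b ]) × (∀ c → LeftSpecial X ((p ++ w) ++ [ c ]) → c ≡ b))
          × (∃ λ m → ℓ≡ X ((p ++ w) ++ [ b ]) m × ℓ≡ X (p ++ w) m)
          × (∃ λ m → ℓ≡ X (w ++ [ b ]) m × ℓ≡ X w m))
lemma5p2 em d X _ (m , dendric) k _ = suc N₂ , s≤s z≤n ,
  λ p w _ _ |p|≤k N₂<|w| pw-special w-special →
    let N₂≤|w| : N₂ ≤ length w
        N₂≤|w| = ≤-trans (n≤1+n N₂) N₂<|w|
        N₁≤|w| : N₁ ≤ length w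
        N₁≤|w| = ≤-trans N₁≤N₂ N₂≤|w|
        b , pwb-special , wb-special =
          common-extension p w |p|≤k N₂≤|w| (special⇒ pw-special) (special⇒ w-special)
        w-unique , w-multiplicity = continuation w b N₁≤|w| w-special wb-special
        pw-unique , pw-multiplicity = continuation (p ++ w) b (≤-length-++ p N₁≤|w|) pw-special pwb-special
    in b , w-unique , pw-unique , pw-multiplicity , w-multiplicity
  where
    open EventuallyDendricShift em X m dendric
    open Multiplicity em X using (special⇒)
    open JointExtension k
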